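{- Let $\mathfrak p=(\mathcal G,F)$ be a regular universality parameter for $\mathbf H$ and let $T\in\mathrm{IFT}[\mathbf H]$ be a $\mathfrak p$-narrow tree. Then there are a $\mathfrak p$-narrow tree $T^*\in\mathrm{IFT}[\mathbf H]$ and a strictly increasing sequence $\bar n=\langle n_k:k<\omega\rangle$ of natural numbers such that (a) $T\subseteq T^*$, and for every $k<\omega$: (b)$_k$ if $\nu_0,\nu_1\in T^*\cap\prod_{i\le n_k}\mathbf H(i)$ and $\bar\pi\in\mathrm{rp}^{n_k}_{\mathbf H}$ satisfy $\bar\pi(\nu_0)=\nu_1$, then $\bar\pi[(T^*)^{[\nu_0]}]=(T^*)^{[\nu_1]}$; (c)$_k$ if $S\in\mathrm{FT}[\mathbf H]$ is such that $\mathrm{lev}(S)=n_{k+1}+1$ and for all $\nu_0\in S\cap\prod_{i\le n_k}\mathbf H(i)$, $\nu_1\in T^*\cap\prod_{i\le n_k}\mathbf H(i)$ and $\bar\pi\in\mathrm{rp}^{n_k}_{\mathbf H}$ with $\bar\pi(\nu_0)=\nu_1$ we have $\bar\pi[S^{[\nu_0]}]\subseteq (T^*)^{[\nu_1]}$, then $(S,n_k+1,n_{k+1})\in\mathcal G$.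
   Context: Fix $\mathbf H:\omega\to\omega\setminus 2$ and let $\mathcal X=\prod_{i<\omega}\mathbf H(i)$ with the product topology. For finite sequences, $\nu\trianglelefteq\eta$ means $\nu$ is an initial segment of $\eta$ ($\vartriangleleft$: proper initial segment), and $\mathrm{lh}(\eta)$ is the length of $\eta$. A finite $\mathbf H$-tree is a set $S\subseteq\bigcup_{n\le N}\prod_{i<n}\mathbf H(i)$ (for some $N<\omega$) containing the empty sequence $\langle\rangle$, closed under initial segments, and such that all its $\trianglelefteq$-maximal elements lie in $\prod_{i<N}\mathbf H(i)$; $\mathrm{lev}(S)=N$ and $\max(S)$ is the set of maximal elements. An infinite $\mathbf H$-tree is a set $T\subseteq\bigcup_{n<\omega}\prod_{i<n}\mathbf H(i)$ containing $\langle\rangle$, closed under initial segments, with no maximal elements; $[T]=\{x\in\mathcal X:\forall n\ x\restriction n\in T\}$. $\mathrm{FT}[\mathbf H]$, $\mathrm{IFT}[\mathbf H]$ denote the sets of finite, resp. infinite, $\mathbf H$-trees. For a tree $T$ and $\eta\in T$, $T^{[\eta]}=\{\nu\in T:\eta\trianglelefteq\nu\}$. A simplified universality parameter for $\mathbf H$ is a pair $\mathfrak p=(\mathcal G,F)$ such that: ($\alpha$) $\mathcal G$ is a set of triples $(S,n_{dn},n_{up})$ with $S\in\mathrm{FT}[\mathbf H]$, $n_{dn}\le n_{up}\le\mathrm{lev}(S)$, and $(\{\langle\rangle\},0,0)\in\mathcal G$; ($\beta$) if $(S^0,n^0_{dn},n^0_{up})\in\mathcal G$, $S^1\in\mathrm{FT}[\mathbf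 H]$, $\mathrm{lev}(S^0)\le\mathrm{lev}(S^1)$, $S^1\cap\prod_{i<\mathrm{lev}(S^0)}\mathbf H(i)\subseteq S^0$, $n^1_{dn}\le n^0_{dn}$ and $n^0_{up}\le n^1_{up}\le\mathrm{lev}(S^1)$, then $(S^1,n^1_{dn},n^1_{up})\in\mathcal G$; ($\gamma$) $F:\omega\to\omega$ is increasing; ($\delta$) if $(S^\ell,n^\ell_{dn},n^\ell_{up})\in\mathcal G$ for $\ell<2$ with $\mathrm{lev}(S^0)=\mathrm{lev}(S^1)$, $S\in\mathrm{FT}[\mathbf H]$ with $\mathrm{lev}(S)<\mathrm{lev}(S^\ell)$ and $S^\ell\cap\prod_{i<\mathrm{lev}(S)}\mathbf H(i)\subseteq S$, and $\mathrm{lev}(S)<n^0_{dn}$, $n^0_{up}<n^1_{dn}$, $F(n^1_{up})<\mathrm{lev}(S^1)$, then there is $(S^*,n^*_{dn},n^*_{up})\in\mathcal G$ with $n^*_{dn}=n^0_{dn}$, $n^*_{up}=F(n^1_{up})$, $\mathrm{lev}(S^*)=\mathrm{lev}(S^0)$, $S^0\cup S^1\subseteq S^*$ and $S^*\cap\prod_{i<\mathrm{lev}(S)}\mathbf H(i)=\max(S)$. An infinite $\mathbf H$-tree $T$ is $\mathfrak p$-narrow if for infinitely many $n<\omega$ there is $n_{up}>n$ with $(\{\nu\in T:\mathrm{lh}(\nu)\le n_{up}\},n,n_{up})\in\mathcal G$. $\mathfrak p$ is suitable if: (a) for every $n$ there is $N>n$ such that whenever $(S,n_{dn},n_{up})\in\mathcal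 G$, $N\le n_{dn}$ and $\eta\in\prod_{i<n}\mathbf H(i)$, there is $\nu\in\prod_{i<\mathrm{lev}(S)}\mathbf H(i)$ with $\eta\vartriangleleft\nu$ and $\nu\notin S$; (b) for every $n$ there is $N>n$ such that whenever $S\in\mathrm{FT}[\mathbf H]$, $\mathrm{lev}(S)=n$, $\eta\in\prod_{i<N}\mathbf H(i)$ and $\eta\restriction n\in S$, there is $(S^*,n_{dn},n_{up})\in\mathcal G$ with $n<n_{dn}\le n_{up}<N$, $S\subseteq S^*$, $S^*\cap\prod_{i<n}\mathbf H(i)=\max(S)$ and $\eta\in S^*$. A coordinate-wise permutation for $\mathbf H$ is a sequence $\bar\pi=\langle\pi_n:n<\omega\rangle$ of bijections $\pi_n:\mathbf H(n)\to\mathbf H(n)$; it is an $n$-coordinate-wise permutation if $\pi_i$ is the identity for all $i>n$. $\mathrm{rp}^n_{\mathbf H}$ is the set of $n$-coordinate-wise permutations and $\mathrm{rp}_{\mathbf H}=\bigcup_n\mathrm{rp}^n_{\mathbf H}$ (rational permutations). $\bar\pi$ acts on sequences $\eta\in\prod_{i<n}\mathbf H(i)$ ($n\le\omega$) by $\bar\pi(\eta)(i)=\pi_i(\eta(i))$; $\bar\pi[X]$ is the pointwise image of a set $X$. $\mathfrak p$ is a regular universality parameter if it is suitable and $\mathcal G$ is invariant under rational permutations: if $\bar\pi\in\mathrm{rp}_{\mathbf H}$ and $(S,n_{dn},n_{up})\in\mathcal G$ then $(\bar\pi[S],n_{dn},n_{up})\in\mathcal G$. -}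

module Defs where

open import Data.Nat using (ℕ; zero; suc; _<_; _≤_)
open import Data.List using (List; []; _∷_; _++_; length; take)
open import Data.Product using (Σ; _×_; _,_; ∃)
open import Data.Unit using (⊤)
open import Data.Empty using (⊥)
open import Relation.Binary.PropositionalEquality using (_≡_; _≢_)
open import Function.Bundles using (_⇔_)

-- Finite sequences of naturals; H(i) is identified with {0,…,H i - 1}.
Seq : Set
Seq = List ℕ

SeqSet : Set₁
SeqSet = Seq → Set

_⊆ₛ_ : SeqSet → SeqSet → Set
A ⊆ₛ B = ∀ η → A η → B η

_≐ₛ_ : SeqSet → SeqSet → Set
A ≐ₛ B = (A ⊆ₛ B) × (B ⊆ₛ A)

ValidFrom : (ℕ → ℕ) → ℕ → Seq → Set
ValidFrom H k [] = ⊤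
ValidFrom H k (x ∷ η) = (x < H k) × ValidFrom H (suc k) η

Valid : (ℕ → ℕ) → Seq → Set
Valid H = ValidFrom H 0

InProd : (ℕ → ℕ) → ℕ → Seq → Set
InProd H n η = Valid H η × (length η ≡ n)

_⊴_ : Seq → Seq → Set
ν ⊴ η = Σ Seq (λ ρ → ν ++ ρ ≡ η)

_◁_ : Seq → Seq → Set
ν ◁ η = (ν ⊴ η) × (ν ≢ η)

Above : SeqSet → Seq → SeqSet
Above T η ν = T ν × (η ⊴ ν)

Max : SeqSet → SeqSet
Max S η = S η × (∀ ν → S ν → η ⊴ ν → ν ≡ η)

record IsFT (H : ℕ → ℕ) (S : SeqSet) (N : ℕ) : Set where
  field
    valid  : ∀ η → S η → Valid H η × (length η ≤ N)
    root   : S []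
    closed : ∀ ν η → ν ⊴ η → S η → S ν
    maxTop : ∀ η → Max S η → length η ≡ N

record IsIFT (H : ℕ → ℕ) (T : SeqSet) : Set where
  field
    valid   : ∀ η → T η → Valid H η
    root    : T []
    closed  : ∀ ν η → ν ⊴ η → T η → T ν
    noMax   : ∀ η → T η → ∃ (λ ν → T ν × (η ◁ ν))

Singleton : Seq → SeqSet
Singleton η ν = ν ≡ η

UpTo : SeqSet → ℕ → SeqSet
UpTo T m ν = T ν × (length ν ≤ m)

-- simplified universality parameter (G, F)
record UnivParam (H : ℕ → ℕ) : Set₁ where
  field
    G : SeqSet → ℕ → ℕ → Set
    F : ℕ → ℕ
    α-FT    : ∀ S a b → G S a b → ∃ (λ N → IsFT H S N × (a ≤ b) × (b ≤ N))
    α-root  : G (Singleton []) 0 0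
    β : ∀ S₀ a₀ b₀ N₀ S₁ a₁ b₁ N₁ → G S₀ a₀ b₀ → IsFT H S₀ N₀ → IsFT H S₁ N₁ →
        N₀ ≤ N₁ → (∀ η → S₁ η → length η ≡ N₀ → S₀ η) →
        a₁ ≤ a₀ → b₀ ≤ b₁ → b₁ ≤ N₁ → G S₁ a₁ b₁
    γ : ∀ m n → m < n → F m < F n
    δ : ∀ S₀ a₀ b₀ S₁ a₁ b₁ N S M → G S₀ a₀ b₀ → G S₁ a₁ b₁ →
        IsFT H S₀ N → IsFT H S₁ N → IsFT H S M → M < N →
        (∀ η → S₀ η → length η ≡ M → S η) → (∀ η → S₁ η → length η ≡ M → S η) →
        M < a₀ → b₀ < a₁ → F b₁ < N →
        Σ SeqSet (λ S* → G S* a₀ (F b₁) × IsFT H S* N × (S₀ ⊆ₛ S*) × (S₁ ⊆ₛ S*) ×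
          (∀ η → (S* η × (length η ≡ M)) ⇔ Max S η))

Narrow : (H : ℕ → ℕ) → UnivParam H → SeqSet → Set
Narrow H p T = ∀ m → ∃ (λ n → (m ≤ n) × ∃ (λ nup → (n < nup) × G (UpTo T nup) n nup))
  where open UnivParam p

record CoordPerm (H : ℕ → ℕ) : Set where
  field
    π   : ℕ → ℕ → ℕ
    π⁻¹ : ℕ → ℕ → ℕ
    π<   : ∀ i x → x < H i → π i x < H i
    π⁻¹< : ∀ i x → x < H i → π⁻¹ i x < H i
    left  : ∀ i x → x < H i → π⁻¹ i (π i x) ≡ x
    right : ∀ i x → x < H i → π i (π⁻¹ i x) ≡ x

IsNPerm : {H : ℕ → ℕ} → CoordPerm H → ℕ → Set
IsNPerm {H} p n = ∀ i → n < i → ∀ x → x < H i → CoordPerm.π p i x ≡ x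

actFrom : (ℕ → ℕ → ℕ) → ℕ → Seq → Seq
actFrom π k [] = []
actFrom π k (x ∷ η) = π k x ∷ actFrom π (suc k) η

act : {H : ℕ → ℕ} → CoordPerm H → Seq → Seq
act p = actFrom (CoordPerm.π p) 0

image : {H : ℕ → ℕ} → CoordPerm H → SeqSet → SeqSet
image p X ν = ∃ (λ η → X η × (act p η ≡ ν))

record Suitable (H : ℕ → ℕ) (p : UnivParam H) : Set₁ where
  open UnivParam p
  field
    suit-a : ∀ n → ∃ (λ N → (n < N) × (∀ S a b L → G S a b → IsFT H S L → N ≤ a →
               ∀ η → InProd H n η → ∃ (λ ν → InProd H L ν × (η ◁ ν) × (S ν → ⊥))))
    suit-b : ∀ n → ∃ (λ N → (n < N) × (∀ S → IsFT H S n → ∀ η → InProd H N η → S (take n η) →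
               Σ SeqSet (λ S* → ∃ (λ a → ∃ (λ b → G S* a b × (n < a) × (a ≤ b) × (b < N) ×
                 (S ⊆ₛ S*) × (∀ ν → (S* ν × (length ν ≡ n)) ⇔ Max S ν) × S* η)))))

record Regular (H : ℕ → ℕ) (p : UnivParam H) : Set₁ where
  open UnivParam p
  field
    suitable  : Suitable H p
    invariant : ∀ (π : CoordPerm H) n → IsNPerm π n → ∀ S a b → G S a b → G (image π S) a b

StrictlyIncreasing : (ℕ → ℕ) → Set
StrictlyIncreasing f = ∀ i j → i < j → f i < f j

{-# OPTIONS --safe #-}
-- Cut ω at 0 < n₀+1 < n₁+1 < ⋯ and let T* consist of the sequences each of whose blocks is the
-- corresponding block of some node of T of the same length. T* contains T, and an n_k-coordinate-wise
-- permutation carrying ν₀ to ν₁ (of length n_k+1) only changes blocks lying inside ν₀, so it maps the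
-- cone of T* above ν₀ onto the cone above ν₁: this is (b). For (c), swap the first n_k+1 entries of a
-- top node ν of S with those of a node of T; by hypothesis the result lies in T*, so its last block comes
-- from a node θ of T, and ν is the image of θ under a coordinate-wise transposition. Only finitely many
-- such transpositions exist, and n_{k+1} is taken so large that (δ), applied once for each of them using
-- the narrowness of T and the invariance of 𝒢, yields one member of 𝒢 containing all their images of T;
-- (β) then puts (S, n_k+1, n_{k+1}) in 𝒢. Applying (c) to T* itself shows that T* is narrow.
module Submission where

open import Defs
open import Data.Nat using (ℕ; zero; suc; _+_; _≤_; _<_; z≤n; s≤s; _<?_; _≟_)
open import Data.Nat.Properties
  using (suc-injective; m≤n⇒m⊓n≡m; ≤-refl; ≤-reflexive; ≤-trans; <-trans; ≤-<-trans; <-≤-trans; <⇒≤; <⇒≱; ≮⇒≥;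
         1+n≰n; <-cmp; +-identityʳ; +-suc; m≤n⇒m<n∨m≡n; m≤n⇒m≤1+n; m≤m+n; m≤n+m; n≤1+n; n<1+n)
open import Data.List using (List; []; _∷_; [_]; _++_; length; take; drop; upTo; cartesianProductWith)
open import Data.List.Properties
  using (∷-injective; length-++; length-++-≤ˡ; length-++-sucʳ; length-take; ++-identityʳ; ++-assoc; ++-cancelˡ; take++drop≡id)
open import Data.List.Membership.Propositional using (_∈_)
open import Data.List.Membership.Propositional.Properties
  using (∈-cartesianProductWith⁺; ∈-cartesianProductWith⁻; ∈-upTo⁺)
open import Data.List.Relation.Unary.All as All using (All; []; _∷_)
open import Data.List.Relation.Unary.Any using (here)
open import Data.Product using (Σ; _×_; _,_; ∃; proj₁; proj₂)
open import Data.Sum using (inj₁; inj₂)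
open import Data.Unit using (tt)
open import Data.Empty using (⊥-elim)
open import Function using (id)
open import Relation.Nullary using (yes; no; contradiction)
open import Relation.Binary.Definitions using (tri<; tri≈; tri>)
open import Relation.Binary.PropositionalEquality hiding ([_])
open ≡-Reasoning

at : Seq → ℕ → ℕ
at []      _       = 0
at (x ∷ η) zero    = x
at (x ∷ η) (suc i) = at η i

at-beyond : ∀ η {i} → length η ≤ i → at η i ≡ 0
at-beyond []      _       = refl
at-beyond (x ∷ η) (s≤s h) = at-beyond η h

at-++ˡ : ∀ η {ρ i} → i < length η → at (η ++ ρ) i ≡ at η i
at-++ˡ (x ∷ η) {i = zero}  _       = refl
at-++ˡ (x ∷ η) {i = suc i} (s≤s h) = at-++ˡ η h

at-++-same-length : ∀ η θ ρ {i} → length η ≡ length θ → length η ≤ i → at (η ++ ρ) i ≡ at (θ ++ ρ) i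
at-++-same-length []      []      ρ _ _ = refl
at-++-same-length []      (_ ∷ _) ρ () _
at-++-same-length (_ ∷ _) []      ρ () _
at-++-same-length (x ∷ η) (y ∷ θ) ρ e (s≤s h) = at-++-same-length η θ ρ (suc-injective e) h

at-∷ʳ : ∀ η x → at (η ++ [ x ]) (length η) ≡ x
at-∷ʳ []      x = refl
at-∷ʳ (y ∷ η) x = at-∷ʳ η x

at-take : ∀ m η {i} → i < m → at (take m η) i ≡ at η i
at-take (suc m) []      _       = refl
at-take (suc m) (x ∷ η) {zero}  _       = refl
at-take (suc m) (x ∷ η) {suc i} (s≤s h) = at-take m η h

≡-by-at : ∀ η θ → length η ≡ length θ → (∀ i → i < length η → at η i ≡ at θ i) → η ≡ θ
≡-by-at []      []      _ _ = refl
≡-by-at []      (_ ∷ _) () _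
≡-by-at (_ ∷ _) []      () _
≡-by-at (x ∷ η) (y ∷ θ) l h =
  cong₂ _∷_ (h 0 (s≤s z≤n)) (≡-by-at η θ (suc-injective l) (λ i i< → h (suc i) (s≤s i<)))

length-∷ʳ : ∀ (η : Seq) x → length (η ++ [ x ]) ≡ suc (length η)
length-∷ʳ []      x = refl
length-∷ʳ (y ∷ η) x = cong suc (length-∷ʳ η x)

length-++-cong : ∀ (η θ ρ σ : Seq) → length η ≡ length θ → length ρ ≡ length σ →
  length (η ++ ρ) ≡ length (θ ++ σ)
length-++-cong η θ _ _ l l′ = trans (length-++ η) (trans (cong₂ _+_ l l′) (sym (length-++ θ)))

length-take-≤ : ∀ {m} (η : Seq) → m ≤ length η → length (take m η) ≡ m
length-take-≤ {m} η m≤ = trans (length-take m η) (m≤n⇒m⊓n≡m m≤)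

⊴-trans : ∀ {ν η θ} → ν ⊴ η → η ⊴ θ → ν ⊴ θ
⊴-trans {ν} (ρ , refl) (σ , refl) = ρ ++ σ , sym (++-assoc ν ρ σ)

⊴-length : ∀ {ν η} → ν ⊴ η → length ν ≤ length η
⊴-length {ν} (ρ , refl) = length-++-≤ˡ ν

⊴-at : ∀ {ν η i} → ν ⊴ η → i < length ν → at ν i ≡ at η i
⊴-at {ν} (ρ , refl) i< = sym (at-++ˡ ν i<)

take-⊴ : ∀ m η → take m η ⊴ η
take-⊴ m η = drop m η , take++drop≡id m η

⊴-length-≡ : ∀ {ν η} → ν ⊴ η → length η ≤ length ν → η ≡ ν
⊴-length-≡ {ν} ([]     , refl) _ = ++-identityʳ ν
⊴-length-≡ {ν} (x ∷ ρ , refl) h =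
  contradiction (≤-trans (s≤s (length-++-≤ˡ ν)) (≤-trans (≤-reflexive (sym (length-++-sucʳ ν x ρ))) h)) 1+n≰n

∷ʳ-≢ : ∀ (η : Seq) x → η ≢ η ++ [ x ]
∷ʳ-≢ η x e with ++-cancelˡ η [] [ x ] (trans (++-identityʳ η) e)
... | ()

AgreeOn : ℕ → ℕ → Seq → Seq → Set
AgreeOn a b η θ = ∀ i → a ≤ i → i < b → at η i ≡ at θ i

AgreeOn-∷ʳ : ∀ {a b} η x θ y → length η ≡ length θ → AgreeOn a b η θ →
  (a ≤ length η → length η < b → x ≡ y) → AgreeOn a b (η ++ [ x ]) (θ ++ [ y ])
AgreeOn-∷ʳ η x θ y l agree x≡y i a≤i i<b with <-cmp i (length η)
... | tri< i<η _ _ = begin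
  at (η ++ [ x ]) i  ≡⟨ at-++ˡ η i<η ⟩
  at η i             ≡⟨ agree i a≤i i<b ⟩
  at θ i             ≡⟨ at-++ˡ θ (subst (i <_) l i<η) ⟨
  at (θ ++ [ y ]) i  ∎
... | tri≈ _ refl _ = begin
  at (η ++ [ x ]) (length η)  ≡⟨ at-∷ʳ η x ⟩
  x                           ≡⟨ x≡y a≤i i<b ⟩
  y                           ≡⟨ subst (λ j → at (θ ++ [ y ]) j ≡ y) (sym l) (at-∷ʳ θ y) ⟨
  at (θ ++ [ y ]) (length η)  ∎
... | tri> _ _ η<i = trans (at-beyond (η ++ [ x ]) (≤-trans (≤-reflexive (length-∷ʳ η x)) η<i))
  (sym (at-beyond (θ ++ [ y ]) (≤-trans (≤-reflexive (trans (length-∷ʳ θ y) (cong suc (sym l)))) η<i)))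

ValidFrom-++⁺ : ∀ {H} k η {ρ} → ValidFrom H k η → ValidFrom H (k + length η) ρ → ValidFrom H k (η ++ ρ)
ValidFrom-++⁺ {H} k []      {ρ} _        v = subst (λ j → ValidFrom H j ρ) (+-identityʳ k) v
ValidFrom-++⁺ {H} k (x ∷ η) {ρ} (x< , vη) v =
  x< , ValidFrom-++⁺ (suc k) η vη (subst (λ j → ValidFrom H j ρ) (+-suc k (length η)) v)

ValidFrom-++⁻ˡ : ∀ {H} k η {ρ} → ValidFrom H k (η ++ ρ) → ValidFrom H k η
ValidFrom-++⁻ˡ k []      _        = tt
ValidFrom-++⁻ˡ k (x ∷ η) (x< , v) = x< , ValidFrom-++⁻ˡ (suc k) η v

ValidFrom-++⁻ʳ : ∀ {H} k η {ρ} → ValidFrom H k (η ++ ρ) → ValidFrom H (k + length η) ρ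
ValidFrom-++⁻ʳ {H} k []      {ρ} v        = subst (λ j → ValidFrom H j ρ) (sym (+-identityʳ k)) v
ValidFrom-++⁻ʳ {H} k (x ∷ η) {ρ} (_ , v) =
  subst (λ j → ValidFrom H j ρ) (sym (+-suc k (length η))) (ValidFrom-++⁻ʳ (suc k) η v)

ValidFrom-at : ∀ {H} k η {i} → ValidFrom H k η → i < length η → at η i < H (k + i)
ValidFrom-at {H} k (x ∷ η) {zero}  (x< , _) _       = subst (λ j → x < H j) (sym (+-identityʳ k)) x<
ValidFrom-at {H} k (x ∷ η) {suc i} (_ , v)  (s≤s h) =
  subst (λ j → at η i < H j) (sym (+-suc k i)) (ValidFrom-at (suc k) η v h)

length-actFrom : ∀ π k η → length (actFrom π k η) ≡ length η
length-actFrom π k []      = refl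
length-actFrom π k (x ∷ η) = cong suc (length-actFrom π (suc k) η)

actFrom-++ : ∀ π k η ρ → actFrom π k (η ++ ρ) ≡ actFrom π k η ++ actFrom π (k + length η) ρ
actFrom-++ π k []      ρ = cong (λ j → actFrom π j ρ) (sym (+-identityʳ k))
actFrom-++ π k (x ∷ η) ρ = cong (π k x ∷_) (trans (actFrom-++ π (suc k) η ρ)
  (cong (λ j → actFrom π (suc k) η ++ actFrom π j ρ) (sym (+-suc k (length η)))))

at-actFrom : ∀ π k η {i} → i < length η → at (actFrom π k η) i ≡ π (k + i) (at η i)
at-actFrom π k (x ∷ η) {zero}  _       = cong (λ j → π j x) (sym (+-identityʳ k))
at-actFrom π k (x ∷ η) {suc i} (s≤s h) =
  trans (at-actFrom π (suc k) η h) (cong (λ j → π j (at η i)) (sym (+-suc k i)))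

ValidFrom-actFrom : ∀ {H} π → (∀ i x → x < H i → π i x < H i) → ∀ k η → ValidFrom H k η → ValidFrom H k (actFrom π k η)
ValidFrom-actFrom π π< k []      _        = tt
ValidFrom-actFrom π π< k (x ∷ η) (x< , v) = π< k x x< , ValidFrom-actFrom π π< (suc k) η v

⊴-actFrom⁺ : ∀ π k {η η′} → η ⊴ η′ → actFrom π k η ⊴ actFrom π k η′
⊴-actFrom⁺ π k {η} (ρ , refl) = actFrom π (k + length η) ρ , sym (actFrom-++ π k η ρ)

⊴-actFrom⁻ : ∀ π k ν η → ν ⊴ actFrom π k η → Σ Seq λ η′ → η′ ⊴ η × actFrom π k η′ ≡ ν
⊴-actFrom⁻ π k []      η       _       = [] , (η , refl) , refl
⊴-actFrom⁻ π k (y ∷ ν) (x ∷ η) (ρ , e) with refl , e′ ← ∷-injective e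
  with η′ , (σ , refl) , refl ← ⊴-actFrom⁻ π (suc k) ν η (ρ , e′) = x ∷ η′ , (σ , refl) , refl

-- IsNPerm π n is, definitionally, FixesFrom H (CoordPerm.π π) (suc n).
FixesFrom : (ℕ → ℕ) → (ℕ → ℕ → ℕ) → ℕ → Set
FixesFrom H π k = ∀ i → k ≤ i → ∀ x → x < H i → π i x ≡ x

actFrom-fixed : ∀ {H} π k ρ → FixesFrom H π k → ValidFrom H k ρ → actFrom π k ρ ≡ ρ
actFrom-fixed π k []      _   _        = refl
actFrom-fixed π k (x ∷ ρ) fix (x< , v) =
  cong₂ _∷_ (fix k ≤-refl x x<) (actFrom-fixed π (suc k) ρ (λ i k<i → fix i (<⇒≤ k<i)) v)

act-++-fixed : ∀ {H} (π : CoordPerm H) η ρ → FixesFrom H (CoordPerm.π π) (length η) → Valid H (η ++ ρ) →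
  act π (η ++ ρ) ≡ act π η ++ ρ
act-++-fixed π η ρ fix v = trans (actFrom-++ (CoordPerm.π π) 0 η ρ)
  (cong (act π η ++_) (actFrom-fixed (CoordPerm.π π) (length η) ρ fix (ValidFrom-++⁻ʳ 0 η v)))

step⇒strictlyIncreasing : ∀ {f : ℕ → ℕ} → (∀ k → f k < f (suc k)) → StrictlyIncreasing f
step⇒strictlyIncreasing step i (suc j) (s≤s i≤j) with m≤n⇒m<n∨m≡n i≤j
... | inj₁ i<j  = <-trans (step⇒strictlyIncreasing step i j i<j) (step j)
... | inj₂ refl = step j

strictlyIncreasing⇒monotone : ∀ {f : ℕ → ℕ} → StrictlyIncreasing f → ∀ {i j} → i ≤ j → f i ≤ f j
strictlyIncreasing⇒monotone inc {i} {j} i≤j with m≤n⇒m<n∨m≡n i≤j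
... | inj₁ i<j  = <⇒≤ (inc i j i<j)
... | inj₂ refl = ≤-refl

strictlyIncreasing⇒inflationary : ∀ {f : ℕ → ℕ} → StrictlyIncreasing f → ∀ n → n ≤ f n
strictlyIncreasing⇒inflationary inc zero    = z≤n
strictlyIncreasing⇒inflationary inc (suc n) = ≤-<-trans (strictlyIncreasing⇒inflationary inc n) (inc n (suc n) ≤-refl)

block-of : ∀ {c : ℕ → ℕ} → c 0 ≡ 0 → StrictlyIncreasing c → ∀ ℓ → Σ ℕ λ k → c k ≤ ℓ × ℓ < c (suc k)
block-of {c} c0 inc zero = 0 , ≤-reflexive c0 , subst (_< c 1) c0 (inc 0 1 ≤-refl)
block-of {c} c0 inc (suc ℓ) with block-of c0 inc ℓ
... | k , cₖ≤ℓ , ℓ<cₖ₊₁ with m≤n⇒m<n∨m≡n ℓ<cₖ₊₁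
...   | inj₁ 1+ℓ<cₖ₊₁ = k , m≤n⇒m≤1+n cₖ≤ℓ , 1+ℓ<cₖ₊₁
...   | inj₂ 1+ℓ≡cₖ₊₁ = suc k , ≤-reflexive (sym 1+ℓ≡cₖ₊₁) ,
                         subst (_< c (suc (suc k))) (sym 1+ℓ≡cₖ₊₁) (inc (suc k) (suc (suc k)) ≤-refl)

block-unique : ∀ {c : ℕ → ℕ} → StrictlyIncreasing c → ∀ {j k ℓ} →
  c j ≤ ℓ × ℓ < c (suc j) → c k ≤ ℓ × ℓ < c (suc k) → j ≡ k
block-unique inc {j} {k} (cⱼ≤ℓ , ℓ<cⱼ₊₁) (cₖ≤ℓ , ℓ<cₖ₊₁) with <-cmp j k
... | tri< j<k _ _ = contradiction (≤-trans (strictlyIncreasing⇒monotone inc j<k) cₖ≤ℓ) (<⇒≱ ℓ<cⱼ₊₁)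
... | tri≈ _ j≡k _ = j≡k
... | tri> _ _ k<j = contradiction (≤-trans (strictlyIncreasing⇒monotone inc k<j) cⱼ≤ℓ) (<⇒≱ ℓ<cₖ₊₁)

module _ {H : ℕ → ℕ} {T : SeqSet} (T-IFT : IsIFT H T) where
  open IsIFT T-IFT

  extend-one : ∀ {η} → T η → ∃ λ x → T (η ++ [ x ])
  extend-one {η} t with noMax η t
  ... | ν , tν , ([]    , e) , η≢ν = ⊥-elim (η≢ν (trans (sym (++-identityʳ η)) e))
  ... | ν , tν , (x ∷ ρ , e) , _   = x , closed (η ++ [ x ]) ν (ρ , trans (++-assoc η [ x ] ρ) e) tν

  extend-to : ∀ {η} m → T η → length η ≤ m → Σ Seq λ θ → T θ × η ⊴ θ × length θ ≡ m
  extend-to {η} m t η≤m with m≤n⇒m<n∨m≡n η≤m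
  ... | inj₂ refl = η , t , ([] , ++-identityʳ η) , refl
  extend-to {η} (suc m) t _ | inj₁ (s≤s η≤m) with θ , tθ , η⊴θ , lθ ← extend-to m t η≤m
                                             with x , tx ← extend-one tθ =
    θ ++ [ x ] , tx , ⊴-trans η⊴θ ([ x ] , refl) , trans (length-∷ʳ θ x) (cong suc lθ)

  node-of-length : ∀ m → Σ Seq λ θ → T θ × length θ ≡ m
  node-of-length m with θ , tθ , _ , lθ ← extend-to m root z≤n = θ , tθ , lθ

  UpTo-IsFT : ∀ m → IsFT H (UpTo T m) m
  UpTo-IsFT m = record
    { valid  = λ η (t , η≤m) → valid η t , η≤m
    ; root   = root , z≤n
    ; closed = λ ν η ν⊴η (t , η≤m) → closed ν η ν⊴η t , ≤-trans (⊴-length ν⊴η) η≤m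
    ; maxTop = maxTop
    }
    where
    maxTop : ∀ η → Max (UpTo T m) η → length η ≡ m
    maxTop η ((t , η≤m) , maximal) with θ , tθ , η⊴θ , lθ ← extend-to m t η≤m =
      trans (cong length (sym (maximal θ (tθ , ≤-reflexive lθ) η⊴θ))) lθ

image-IsFT : ∀ {H} (π : CoordPerm H) {S N} → IsFT H S N → IsFT H (image π S) N
image-IsFT {H} π {S} {N} S-FT = record
  { valid  = valid′
  ; root   = [] , root , refl
  ; closed = closed′
  ; maxTop = maxTop′
  }
  where
  open IsFT S-FT
  open CoordPerm π using (π<) renaming (π to f)
  valid′ : ∀ ν → image π S ν → Valid H ν × length ν ≤ N
  valid′ _ (η , s , refl) =
    ValidFrom-actFrom f π< 0 η (proj₁ (valid η s)) , subst (_≤ N) (sym (length-actFrom f 0 η)) (proj₂ (valid η s))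
  closed′ : ∀ ν ν′ → ν ⊴ ν′ → image π S ν′ → image π S ν
  closed′ ν _ ν⊴ (η , s , refl) with η′ , η′⊴η , e ← ⊴-actFrom⁻ f 0 ν η ν⊴ = η′ , closed η′ η η′⊴η s , e
  maxTop′ : ∀ ν → Max (image π S) ν → length ν ≡ N
  maxTop′ _ ((η , s , refl) , maximal) = trans (length-actFrom f 0 η) (maxTop η (s , η-maximal))
    where
    η-maximal : ∀ η′ → S η′ → η ⊴ η′ → η′ ≡ η
    η-maximal η′ s′ η⊴η′ = ⊴-length-≡ η⊴η′ (≤-reflexive (begin
      length η′           ≡⟨ length-actFrom f 0 η′ ⟨
      length (act π η′)   ≡⟨ cong length (maximal _ (η′ , s′ , refl) (⊴-actFrom⁺ f 0 η⊴η′)) ⟩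
      length (act π η)    ≡⟨ length-actFrom f 0 η ⟩
      length η            ∎))

Singleton[]-IsFT : ∀ {H} → IsFT H (Singleton []) 0
Singleton[]-IsFT = record
  { valid  = λ { _ refl → tt , z≤n }
  ; root   = refl
  ; closed = λ { [] _ _ refl → refl ; (_ ∷ _) _ (_ , ()) refl }
  ; maxTop = λ { _ (refl , _) → refl }
  }

module _ {H : ℕ → ℕ} (p : UnivParam H) where
  open UnivParam p

  G-raiseUp : ∀ {S a b b′ N} → G S a b → IsFT H S N → b ≤ b′ → b′ ≤ N → G S a b′
  G-raiseUp {S} {a} {b} {b′} {N} g S-FT b≤b′ b′≤N =
    β S a b N S a b′ N g S-FT S-FT ≤-refl (λ _ s _ → s) ≤-refl b≤b′ b′≤N

  G-UpTo-extend : ∀ {T a b N} → IsIFT H T → G (UpTo T b) a b → b ≤ N → G (UpTo T N) a b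
  G-UpTo-extend {T} {a} {b} {N} T-IFT g b≤N =
    β (UpTo T b) a b b (UpTo T N) a b N g (UpTo-IsFT T-IFT b) (UpTo-IsFT T-IFT N) b≤N
      (λ _ (t , _) l → t , ≤-reflexive l) ≤-refl ≤-refl b≤N

transpose : ℕ → ℕ → ℕ → ℕ
transpose a b x with x ≟ a | x ≟ b
... | yes _ | _     = b
... | no _  | yes _ = a
... | no _  | no _  = x

transpose-a : ∀ a b → transpose a b a ≡ b
transpose-a a b with a ≟ a
... | yes _  = refl
... | no a≢a = ⊥-elim (a≢a refl)

transpose-b : ∀ a b → transpose a b b ≡ a
transpose-b a b with b ≟ a | b ≟ b
... | yes b≡a | _      = b≡a
... | no _    | yes _  = refl
... | no _    | no b≢b = ⊥-elim (b≢b refl)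

transpose-other : ∀ {a b x} → x ≢ a → x ≢ b → transpose a b x ≡ x
transpose-other {a} {b} {x} x≢a x≢b with x ≟ a | x ≟ b
... | yes x≡a | _       = ⊥-elim (x≢a x≡a)
... | no _    | yes x≡b = ⊥-elim (x≢b x≡b)
... | no _    | no _    = refl

transpose-involutive : ∀ a b x → transpose a b (transpose a b x) ≡ x
transpose-involutive a b x with x ≟ a | x ≟ b
... | yes refl | _        = transpose-b x b
... | no _     | yes refl = transpose-a a x
... | no x≢a   | no x≢b   = transpose-other x≢a x≢b

transpose-same : ∀ a x → transpose a a x ≡ x
transpose-same a x with x ≟ a
... | yes x≡a = sym x≡a
... | no _    = refl

transpose-< : ∀ {a b x h} → a < h → b < h → x < h → transpose a b x < h
transpose-< {a} {b} {x} a< b< x< with x ≟ a | x ≟ b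
... | yes _ | _     = b<
... | no _  | yes _ = a<
... | no _  | no _  = x<

Rational : {H : ℕ → ℕ} → CoordPerm H → Set
Rational π = ∃ (IsNPerm π)

module Swaps (H : ℕ → ℕ) where

  swapAt : Seq → Seq → ℕ → ℕ → ℕ
  swapAt τ ρ i with at τ i <? H i | at ρ i <? H i
  ... | yes _ | yes _ = transpose (at τ i) (at ρ i)
  ... | _     | _     = id

  swapAt-< : ∀ τ ρ i x → x < H i → swapAt τ ρ i x < H i
  swapAt-< τ ρ i x x< with at τ i <? H i | at ρ i <? H i
  ... | yes a< | yes b< = transpose-< a< b< x<
  ... | yes _  | no _   = x<
  ... | no _   | _      = x<

  swapAt-involutive : ∀ τ ρ i x → swapAt τ ρ i (swapAt τ ρ i x) ≡ x
  swapAt-involutive τ ρ i x with at τ i <? H i | at ρ i <? H i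
  ... | yes _ | yes _ = transpose-involutive (at τ i) (at ρ i) x
  ... | yes _ | no _  = refl
  ... | no _  | _     = refl

  swapAt-valid : ∀ τ ρ i → at τ i < H i → at ρ i < H i → ∀ x → swapAt τ ρ i x ≡ transpose (at τ i) (at ρ i) x
  swapAt-valid τ ρ i a< b< x with at τ i <? H i | at ρ i <? H i
  ... | yes _   | yes _   = refl
  ... | yes _   | no b≮ = ⊥-elim (b≮ b<)
  ... | no a≮ | _       = ⊥-elim (a≮ a<)

  swapAt-beyond : ∀ τ ρ {i} → length τ ≤ i → length ρ ≤ i → ∀ x → swapAt τ ρ i x ≡ x
  swapAt-beyond τ ρ {i} τ≤i ρ≤i x with at τ i <? H i | at ρ i <? H i
  ... | yes _ | yes _ =
    trans (cong₂ (λ a b → transpose a b x) (at-beyond τ τ≤i) (at-beyond ρ ρ≤i)) (transpose-same 0 x)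
  ... | yes _ | no _  = refl
  ... | no _  | _     = refl

  swap : Seq → Seq → CoordPerm H
  swap τ ρ = record
    { π     = swapAt τ ρ
    ; π⁻¹   = swapAt τ ρ
    ; π<    = swapAt-< τ ρ
    ; π⁻¹<  = swapAt-< τ ρ
    ; left  = λ i x _ → swapAt-involutive τ ρ i x
    ; right = λ i x _ → swapAt-involutive τ ρ i x
    }

  swap-fixesFrom : ∀ {τ ρ k} → length τ ≤ k → length ρ ≤ k → FixesFrom H (swapAt τ ρ) k
  swap-fixesFrom {τ} {ρ} τ≤k ρ≤k i k≤i x _ = swapAt-beyond τ ρ (≤-trans τ≤k k≤i) (≤-trans ρ≤k k≤i) x

  swap-rational : ∀ τ ρ → Rational (swap τ ρ)
  swap-rational τ ρ = length τ + length ρ ,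
    swap-fixesFrom (m≤n⇒m≤1+n (m≤m+n (length τ) (length ρ))) (m≤n⇒m≤1+n (m≤n+m (length ρ) (length τ)))

  swap-maps : ∀ {τ ρ} → Valid H τ → Valid H ρ → length τ ≡ length ρ → act (swap τ ρ) τ ≡ ρ
  swap-maps {τ} {ρ} vτ vρ l = ≡-by-at _ ρ (trans (length-actFrom _ 0 τ) l) λ i i< →
    let i<τ = subst (i <_) (length-actFrom _ 0 τ) i<
        i<ρ = subst (i <_) l i<τ
    in begin
      at (act (swap τ ρ) τ) i               ≡⟨ at-actFrom (swapAt τ ρ) 0 τ i<τ ⟩
      swapAt τ ρ i (at τ i)                 ≡⟨ swapAt-valid τ ρ i (ValidFrom-at 0 τ vτ i<τ) (ValidFrom-at 0 ρ vρ i<ρ) (at τ i) ⟩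
      transpose (at τ i) (at ρ i) (at τ i)  ≡⟨ transpose-a (at τ i) (at ρ i) ⟩
      at ρ i                                ∎

  swap-act : ∀ {τ ρ σ} → Valid H (τ ++ σ) → Valid H ρ → length τ ≡ length ρ → act (swap τ ρ) (τ ++ σ) ≡ ρ ++ σ
  swap-act {τ} {ρ} {σ} v vρ l =
    trans (act-++-fixed (swap τ ρ) τ σ (swap-fixesFrom ≤-refl (≤-reflexive (sym l))) v)
          (cong (_++ σ) (swap-maps (ValidFrom-++⁻ˡ 0 τ v) vρ l))

  sequencesFrom : ℕ → ℕ → List Seq
  sequencesFrom k zero    = [ [] ]
  sequencesFrom k (suc m) = cartesianProductWith _∷_ (upTo (H k)) (sequencesFrom (suc k) m)

  ∈-sequencesFrom : ∀ {k} η → ValidFrom H k η → η ∈ sequencesFrom k (length η)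
  ∈-sequencesFrom []      _        = here refl
  ∈-sequencesFrom (x ∷ η) (x< , v) = ∈-cartesianProductWith⁺ _∷_ (∈-upTo⁺ x<) (∈-sequencesFrom η v)

  swaps : ℕ → List (CoordPerm H)
  swaps s = cartesianProductWith swap (sequencesFrom 0 s) (sequencesFrom 0 s)

  ∈-swaps : ∀ {s τ ρ} → Valid H τ → Valid H ρ → length τ ≡ s → length ρ ≡ s → swap τ ρ ∈ swaps s
  ∈-swaps {τ = τ} {ρ} vτ vρ refl lρ =
    ∈-cartesianProductWith⁺ swap (∈-sequencesFrom τ vτ) (subst (λ m → ρ ∈ sequencesFrom 0 m) lρ (∈-sequencesFrom ρ vρ))

  swaps-rational : ∀ s → All Rational (swaps s)
  swaps-rational s = All.tabulate rational
    where
    rational : ∀ {π} → π ∈ swaps s → Rational π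
    rational π∈ with τ , ρ , _ , _ , refl ← ∈-cartesianProductWith⁻ swap (sequencesFrom 0 s) (sequencesFrom 0 s) π∈ =
      swap-rational τ ρ

module Absorption {H : ℕ → ℕ} (p : UnivParam H) (reg : Regular H p)
  {T : SeqSet} (T-IFT : IsIFT H T) (T-narrow : Narrow H p T) where
  open UnivParam p
  open Regular reg using (invariant)

  dn : ℕ → ℕ
  dn m = proj₁ (T-narrow m)

  ≤dn : ∀ m → m ≤ dn m
  ≤dn m = proj₁ (proj₂ (T-narrow m))

  up : ℕ → ℕ
  up m = proj₁ (proj₂ (proj₂ (T-narrow m)))

  dn<up : ∀ m → dn m < up m
  dn<up m = proj₁ (proj₂ (proj₂ (proj₂ (T-narrow m))))

  G-dn-up : ∀ m → G (UpTo T (up m)) (dn m) (up m)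
  G-dn-up m = proj₂ (proj₂ (proj₂ (proj₂ (T-narrow m))))

  F-inflationary : ∀ x → x ≤ F x
  F-inflationary = strictlyIncreasing⇒inflationary γ

  -- The n_up reached after amalgamating c rational images of T, by (δ), into its narrowness witness at s.
  bound : ℕ → ℕ → ℕ
  bound s zero    = up s
  bound s (suc c) = F (up (suc (bound s c)))

  bound-step : ∀ s c → bound s c < bound s (suc c)
  bound-step s c = ≤-trans (≤dn (suc (bound s c))) (≤-trans (<⇒≤ (dn<up _)) (F-inflationary _))

  <bound : ∀ s c → s < bound s c
  <bound s zero    = ≤-<-trans (≤dn s) (dn<up s)
  <bound s (suc c) = <-trans (<bound s c) (bound-step s c)

  absorb-one : ∀ {s c N W} (π : CoordPerm H) → Rational π → 0 < s → G W (dn s) (bound s c) → IsFT H W N →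
    bound s (suc c) < N →
    Σ SeqSet λ W′ → G W′ (dn s) (bound s (suc c)) × IsFT H W′ N × W ⊆ₛ W′ × image π (UpTo T N) ⊆ₛ W′
  absorb-one {s} {c} {N} {W} π (m , π-perm) 0<s gW W-FT b<N =
    let W′ , gW′ , W′-FT , W⊆W′ , πT⊆W′ , _ =
          δ W (dn s) (bound s c) (image π (UpTo T N)) (dn s′) (up s′) N (Singleton []) 0
            gW gπT W-FT (image-IsFT π (UpTo-IsFT T-IFT N)) Singleton[]-IsFT (≤-<-trans z≤n b<N)
            level0 level0 (<-≤-trans 0<s (≤dn s)) (≤dn s′) b<N
    in W′ , gW′ , W′-FT , W⊆W′ , πT⊆W′
    where
    s′ : ℕ
    s′ = suc (bound s c)
    gπT : G (image π (UpTo T N)) (dn s′) (up s′)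
    gπT = invariant π m π-perm _ _ _ (G-UpTo-extend p T-IFT (G-dn-up s′) (≤-trans (F-inflationary _) (<⇒≤ b<N)))
    level0 : ∀ {S : SeqSet} η → S η → length η ≡ 0 → Singleton [] η
    level0 [] _ _ = refl

  absorb : ∀ {s} → 0 < s → ∀ N (Πs : List (CoordPerm H)) → All Rational Πs → bound s (length Πs) < N →
    Σ SeqSet λ W → G W (dn s) (bound s (length Πs)) × IsFT H W N × All (λ π → image π (UpTo T N) ⊆ₛ W) Πs
  absorb {s} _ N [] [] b<N = UpTo T N , G-UpTo-extend p T-IFT (G-dn-up s) (<⇒≤ b<N) , UpTo-IsFT T-IFT N , []
  absorb {s} 0<s N (π ∷ Πs) (π-rational ∷ rational) b<N =
    let W₀ , gW₀ , W₀-FT , absorbed₀ = absorb 0<s N Πs rational (<-trans (bound-step s (length Πs)) b<N)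
        W , gW , W-FT , W₀⊆W , πT⊆W = absorb-one {c = length Πs} π π-rational 0<s gW₀ W₀-FT b<N
    in W , gW , W-FT , πT⊆W ∷ All.map (λ πT⊆W₀ η w → W₀⊆W η (πT⊆W₀ η w)) absorbed₀

module BlockProduct {H : ℕ → ℕ} {T : SeqSet} (T-IFT : IsIFT H T)
  (c : ℕ → ℕ) (c-zero : c 0 ≡ 0) (c-increasing : StrictlyIncreasing c) where
  open IsIFT T-IFT using (closed)

  RealizedOn : ℕ → ℕ → Seq → Set
  RealizedOn a b η = Σ Seq λ θ → T θ × length θ ≡ length η × AgreeOn a b η θ

  T* : SeqSet
  T* η = Valid H η × (∀ k → RealizedOn (c k) (c (suc k)) η)

  T⊆T* : T ⊆ₛ T*
  T⊆T* η t = IsIFT.valid T-IFT η t , λ _ → η , t , refl , λ _ _ _ → refl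

  T*-closed : ∀ ν η → ν ⊴ η → T* η → T* ν
  T*-closed ν _ (ρ , refl) (v , realized) = ValidFrom-++⁻ˡ 0 ν v , λ k → shorten (realized k)
    where
    shorten : ∀ {a b} → RealizedOn a b (ν ++ ρ) → RealizedOn a b ν
    shorten {a} {b} (θ , t , lθ , agree) = θ′ , closed θ′ θ (take-⊴ (length ν) θ) t , lθ′ , agree′
      where
      θ′ : Seq
      θ′ = take (length ν) θ
      lθ′ : length θ′ ≡ length ν
      lθ′ = length-take-≤ θ (subst (length ν ≤_) (sym lθ) (length-++-≤ˡ ν))
      agree′ : AgreeOn a b ν θ′
      agree′ i a≤i i<b with i <? length ν
      ... | yes i<ν = begin
        at ν i         ≡⟨ at-++ˡ ν i<ν ⟨
        at (ν ++ ρ) i  ≡⟨ agree i a≤i i<b ⟩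
        at θ i         ≡⟨ at-take (length ν) θ i<ν ⟨
        at θ′ i        ∎
      ... | no i≮ν = trans (at-beyond ν (≮⇒≥ i≮ν)) (sym (at-beyond θ′ (subst (_≤ i) (sym lθ′) (≮⇒≥ i≮ν))))

  T*-extend : ∀ {η} → T* η → ∃ λ x → T* (η ++ [ x ])
  T*-extend {η} (v , realized) with K , η∈K ← block-of c-zero c-increasing (length η)
    with θ , t , lθ , agree ← realized K
    with x , tx ← extend-one T-IFT t = x , ValidFrom-++⁺ 0 η v (x<H , tt) , realized′
    where
    x<H : x < H (length η)
    x<H = subst (λ j → x < H j) lθ (proj₁ (ValidFrom-++⁻ʳ 0 θ (IsIFT.valid T-IFT _ tx)))
    realized′ : ∀ j → RealizedOn (c j) (c (suc j)) (η ++ [ x ])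
    realized′ j with j ≟ K
    ... | yes refl = θ ++ [ x ] , tx , length-++-cong θ η [ x ] [ x ] lθ refl , AgreeOn-∷ʳ η x θ x (sym lθ) agree (λ _ _ → refl)
    ... | no j≢K with θⱼ , tⱼ , lⱼ , agreeⱼ ← realized j
      with y , ty ← extend-one T-IFT tⱼ =
      θⱼ ++ [ y ] , ty , length-++-cong θⱼ η [ y ] [ x ] lⱼ refl ,
      AgreeOn-∷ʳ η x θⱼ y (sym lⱼ) agreeⱼ (λ cⱼ≤ <cⱼ₊₁ → ⊥-elim (j≢K (block-unique c-increasing (cⱼ≤ , <cⱼ₊₁) η∈K)))

  T*-IFT : IsIFT H T*
  T*-IFT = record
    { valid  = λ _ → proj₁
    ; root   = tt , λ _ → [] , IsIFT.root T-IFT , refl , λ _ _ _ → refl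
    ; closed = T*-closed
    ; noMax  = noMax
    }
    where
    noMax : ∀ η → T* η → ∃ λ ν → T* ν × η ◁ ν
    noMax η t with x , tx ← T*-extend t = η ++ [ x ] , tx , ([ x ] , refl) , ∷ʳ-≢ η x

  -- Blocks below c K are taken from ν₀, the others from ν₁ ++ ρ.
  T*-graft : ∀ K {ν₀ ν₁ ρ} → T* ν₀ → T* (ν₁ ++ ρ) → length ν₀ ≡ c K → length ν₁ ≡ c K → T* (ν₀ ++ ρ)
  T*-graft K {ν₀} {ν₁} {ρ} (v₀ , realized₀) (v₁ , realized₁) l₀ l₁ = v , realized
    where
    l : length ν₁ ≡ length ν₀
    l = trans l₁ (sym l₀)
    v : Valid H (ν₀ ++ ρ)
    v = ValidFrom-++⁺ 0 ν₀ v₀ (subst (λ m → ValidFrom H m ρ) l (ValidFrom-++⁻ʳ 0 ν₁ v₁))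
    realized : ∀ j → RealizedOn (c j) (c (suc j)) (ν₀ ++ ρ)
    realized j with j <? K
    ... | yes j<K with θ , t , lθ , agree ← realized₀ j
      with θ′ , t′ , θ⊴θ′ , lθ′ ← extend-to T-IFT (length (ν₀ ++ ρ)) t (subst (_≤ _) (sym lθ) (length-++-≤ˡ ν₀)) =
      θ′ , t′ , lθ′ , agree′
      where
      agree′ : AgreeOn (c j) (c (suc j)) (ν₀ ++ ρ) θ′
      agree′ i cⱼ≤i i<cⱼ₊₁ = begin
        at (ν₀ ++ ρ) i  ≡⟨ at-++ˡ ν₀ i<ν₀ ⟩
        at ν₀ i         ≡⟨ agree i cⱼ≤i i<cⱼ₊₁ ⟩
        at θ i          ≡⟨ ⊴-at θ⊴θ′ (subst (i <_) (sym lθ) i<ν₀) ⟩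
        at θ′ i         ∎
        where
        i<ν₀ : i < length ν₀
        i<ν₀ = <-≤-trans i<cⱼ₊₁ (subst (c (suc j) ≤_) (sym l₀) (strictlyIncreasing⇒monotone c-increasing j<K))
    ... | no j≮K with θ , t , lθ , agree ← realized₁ j =
      θ , t , trans lθ (length-++-cong ν₁ ν₀ ρ ρ l refl) ,
      λ i cⱼ≤i i<cⱼ₊₁ → trans (at-++-same-length ν₀ ν₁ ρ (sym l) (ν₀≤ cⱼ≤i)) (agree i cⱼ≤i i<cⱼ₊₁)
      where
      ν₀≤ : ∀ {i} → c j ≤ i → length ν₀ ≤ i
      ν₀≤ cⱼ≤i = subst (_≤ _) (sym l₀) (≤-trans (strictlyIncreasing⇒monotone c-increasing (≮⇒≥ j≮K)) cⱼ≤i)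

  T*-perm-invariant : ∀ K ν₀ ν₁ → T* ν₀ → length ν₀ ≡ c K → T* ν₁ → length ν₁ ≡ c K →
    ∀ (π : CoordPerm H) → FixesFrom H (CoordPerm.π π) (c K) → act π ν₀ ≡ ν₁ →
    image π (Above T* ν₀) ≐ₛ Above T* ν₁
  T*-perm-invariant K ν₀ ν₁ t₀ l₀ t₁ l₁ π fix π₀≡ν₁ = forward , backward
    where
    moves : ∀ ρ → Valid H (ν₀ ++ ρ) → act π (ν₀ ++ ρ) ≡ ν₁ ++ ρ
    moves ρ v = trans (act-++-fixed π ν₀ ρ (subst (FixesFrom H (CoordPerm.π π)) (sym l₀) fix) v) (cong (_++ ρ) π₀≡ν₁)
    forward : image π (Above T* ν₀) ⊆ₛ Above T* ν₁
    forward _ (_ , (t , (ρ , refl)) , refl) =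
      subst (Above T* ν₁) (sym (moves ρ (proj₁ t))) (T*-graft K t₁ t l₁ l₀ , (ρ , refl))
    backward : Above T* ν₁ ⊆ₛ image π (Above T* ν₀)
    backward _ (t , (ρ , refl)) = ν₀ ++ ρ , (t′ , (ρ , refl)) , moves ρ (proj₁ t′)
      where
      t′ : T* (ν₀ ++ ρ)
      t′ = T*-graft K t₀ t l₀ l₁

  T*-last-block : ∀ K {ν σ} → T* (ν ++ σ) → length ν ≡ c K → length (ν ++ σ) ≡ c (suc K) →
    Σ Seq λ τ → T (τ ++ σ) × length τ ≡ c K
  T*-last-block K {ν} {σ} (_ , realized) lν lνσ with θ , t , lθ , agree ← realized K = τ , subst T θ≡τσ t , lτ
    where
    τ : Seq
    τ = take (c K) θ
    lτ : length τ ≡ c K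
    lτ = length-take-≤ θ (subst (c K ≤_) (sym (trans lθ lνσ)) (strictlyIncreasing⇒monotone c-increasing (n≤1+n K)))
    ν≡τ : length ν ≡ length τ
    ν≡τ = trans lν (sym lτ)
    pointwise : ∀ i → i < length θ → at θ i ≡ at (τ ++ σ) i
    pointwise i i<θ with i <? c K
    ... | yes i<K = trans (sym (at-take (c K) θ i<K)) (sym (at-++ˡ τ (subst (i <_) (sym lτ) i<K)))
    ... | no i≮K = begin
      at θ i        ≡⟨ agree i (≮⇒≥ i≮K) (subst (i <_) (trans lθ lνσ) i<θ) ⟨
      at (ν ++ σ) i ≡⟨ at-++-same-length ν τ σ ν≡τ (subst (_≤ i) (sym lν) (≮⇒≥ i≮K)) ⟩
      at (τ ++ σ) i ∎
    θ≡τσ : θ ≡ τ ++ σ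
    θ≡τσ = ≡-by-at θ (τ ++ σ) (trans lθ (length-++-cong ν τ σ σ ν≡τ refl)) pointwise

module Construction {H : ℕ → ℕ} (p : UnivParam H) (reg : Regular H p)
  {T : SeqSet} (T-IFT : IsIFT H T) (T-narrow : Narrow H p T) where
  open UnivParam p
  open Absorption p reg T-IFT T-narrow
  open Swaps H

  n : ℕ → ℕ
  n zero    = 0
  n (suc k) = bound (suc (n k)) (length (swaps (suc (n k))))

  n-strictlyIncreasing : StrictlyIncreasing n
  n-strictlyIncreasing = step⇒strictlyIncreasing λ k → <-trans (n<1+n (n k)) (<bound (suc (n k)) (length (swaps (suc (n k)))))

  boundary : ℕ → ℕ
  boundary zero    = 0
  boundary (suc k) = suc (n k)

  boundary-strictlyIncreasing : StrictlyIncreasing boundary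
  boundary-strictlyIncreasing = step⇒strictlyIncreasing step
    where
    step : ∀ k → boundary k < boundary (suc k)
    step zero    = s≤s z≤n
    step (suc k) = s≤s (n-strictlyIncreasing k (suc k) ≤-refl)

  open BlockProduct T-IFT boundary refl boundary-strictlyIncreasing public

  PermutedInto : ℕ → SeqSet → Set
  PermutedInto k S = ∀ ν₀ ν₁ → S ν₀ → length ν₀ ≡ suc (n k) → T* ν₁ → length ν₁ ≡ suc (n k) →
    ∀ (π : CoordPerm H) → IsNPerm π (n k) → act π ν₀ ≡ ν₁ → image π (Above S ν₀) ⊆ₛ Above T* ν₁

  swapped-node∈T* : ∀ k {S N ν₀ ν₁ σ} → IsFT H S N → PermutedInto k S → S (ν₀ ++ σ) →
    length ν₀ ≡ suc (n k) → T ν₁ → length ν₁ ≡ suc (n k) → T* (ν₁ ++ σ)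
  swapped-node∈T* k {S} {_} {ν₀} {ν₁} {σ} S-FT S↪T* sν lν₀ tν₁ lν₁ =
    proj₁ (S↪T* ν₀ ν₁ sν₀ lν₀ (T⊆T* ν₁ tν₁) lν₁ (swap ν₀ ν₁)
      (swap-fixesFrom (≤-reflexive lν₀) (≤-reflexive lν₁)) (swap-maps vν₀ vν₁ l)
      (ν₁ ++ σ) (ν₀ ++ σ , (sν , (σ , refl)) , swap-act vν vν₁ l))
    where
    vν : Valid H (ν₀ ++ σ)
    vν = proj₁ (IsFT.valid S-FT _ sν)
    vν₀ : Valid H ν₀
    vν₀ = ValidFrom-++⁻ˡ 0 ν₀ vν
    vν₁ : Valid H ν₁
    vν₁ = IsIFT.valid T-IFT ν₁ tν₁
    l : length ν₀ ≡ length ν₁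
    l = trans lν₀ (sym lν₁)
    sν₀ : S ν₀
    sν₀ = IsFT.closed S-FT ν₀ (ν₀ ++ σ) (σ , refl) sν

  top-node∈swap-image : ∀ k {S} ν₀ σ → IsFT H S (suc (n (suc k))) → PermutedInto k S → S (ν₀ ++ σ) →
    length ν₀ ≡ suc (n k) → length (ν₀ ++ σ) ≡ suc (n (suc k)) →
    Σ (CoordPerm H) λ π → π ∈ swaps (suc (n k)) × image π (UpTo T (suc (n (suc k)))) (ν₀ ++ σ)
  top-node∈swap-image k ν₀ σ S-FT S↪T* sν lν₀ lν
    with ν₁ , tν₁ , lν₁ ← node-of-length T-IFT (suc (n k))
    with τ , tτσ , lτ ← T*-last-block (suc k) (swapped-node∈T* k S-FT S↪T* sν lν₀ tν₁ lν₁) lν₁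
                          (trans (length-++-cong ν₁ ν₀ σ σ (trans lν₁ (sym lν₀)) refl) lν) =
    swap τ ν₀ , ∈-swaps (ValidFrom-++⁻ˡ 0 τ vτσ) vν₀ lτ lν₀ ,
    τ ++ σ , (tτσ , ≤-reflexive (trans (length-++-cong τ ν₀ σ σ (trans lτ (sym lν₀)) refl) lν)) ,
    swap-act vτσ vν₀ (trans lτ (sym lν₀))
    where
    vτσ : Valid H (τ ++ σ)
    vτσ = IsIFT.valid T-IFT _ tτσ
    vν₀ : Valid H ν₀
    vν₀ = ValidFrom-++⁻ˡ 0 ν₀ (proj₁ (IsFT.valid S-FT _ sν))

  PermutedInto⇒G : ∀ k S → IsFT H S (suc (n (suc k))) → PermutedInto k S → G S (suc (n k)) (n (suc k))
  PermutedInto⇒G k S S-FT S↪T*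
    with W , gW , W-FT , swaps⊆W ← absorb {suc (n k)} (s≤s z≤n) (suc (n (suc k))) (swaps (suc (n k))) (swaps-rational (suc (n k))) ≤-refl =
    β W (dn s) (n (suc k)) L S s (n (suc k)) L gW W-FT S-FT ≤-refl top⊆W (≤dn s) ≤-refl (n≤1+n _)
    where
    s L : ℕ
    s = suc (n k)
    L = suc (n (suc k))
    top⊆W : ∀ ν → S ν → length ν ≡ L → W ν
    top⊆W ν sν lν =
      let π , π∈ , img = top-node∈swap-image k (take s ν) (drop s ν) S-FT S↪T* (subst S (sym ν≡) sν) lν₀ (trans (cong length ν≡) lν)
      in subst W ν≡ (All.lookup swaps⊆W π∈ _ img)
      where
      ν≡ : take s ν ++ drop s ν ≡ ν
      ν≡ = take++drop≡id s ν
      lν₀ : length (take s ν) ≡ s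
      lν₀ = length-take-≤ ν (subst (s ≤_) (sym lν) (s≤s (<⇒≤ (n-strictlyIncreasing k (suc k) ≤-refl))))

  T*-narrow : Narrow H p T*
  T*-narrow m = suc (n m) , m≤n⇒m≤1+n (strictlyIncreasing⇒inflationary n-strictlyIncreasing m) ,
    L , s≤s (n-strictlyIncreasing m (suc m) ≤-refl) ,
    G-raiseUp p (PermutedInto⇒G m (UpTo T* L) L-FT UpTo-permutedInto) L-FT (n≤1+n _) ≤-refl
    where
    L : ℕ
    L = suc (n (suc m))
    L-FT : IsFT H (UpTo T* L) L
    L-FT = UpTo-IsFT T*-IFT L
    UpTo-permutedInto : PermutedInto m (UpTo T* L)
    UpTo-permutedInto ν₀ ν₁ (t₀ , _) l₀ t₁ l₁ π π-perm π₀≡ν₁ η (ξ , ((tξ , _) , ν₀⊴ξ) , πξ≡η) =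
      proj₁ (T*-perm-invariant (suc m) ν₀ ν₁ t₀ l₀ t₁ l₁ π π-perm π₀≡ν₁) η (ξ , (tξ , ν₀⊴ξ) , πξ≡η)

-- The hypothesis 2 ≤ H i is not needed: every entry of a node of T* is copied from a node of T.
lemma2p16 : (H : ℕ → ℕ) → (∀ i → 2 ≤ H i) → (p : UnivParam H) → Regular H p →
    (T : SeqSet) → IsIFT H T → Narrow H p T →
    Σ SeqSet (λ T* → ∃ (λ n →
      IsIFT H T* × Narrow H p T* × StrictlyIncreasing n ×
      (T ⊆ₛ T*) ×
      (∀ k →
        (∀ ν₀ ν₁ → T* ν₀ → length ν₀ ≡ suc (n k) → T* ν₁ → length ν₁ ≡ suc (n k) →
          ∀ (π : CoordPerm H) → IsNPerm π (n k) → act π ν₀ ≡ ν₁ →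
          image π (Above T* ν₀) ≐ₛ Above T* ν₁)
        ×
        (∀ S → IsFT H S (suc (n (suc k))) →
          (∀ ν₀ ν₁ → S ν₀ → length ν₀ ≡ suc (n k) → T* ν₁ → length ν₁ ≡ suc (n k) →
            ∀ (π : CoordPerm H) → IsNPerm π (n k) → act π ν₀ ≡ ν₁ →
            image π (Above S ν₀) ⊆ₛ Above T* ν₁) →
          UnivParam.G p S (suc (n k)) (n (suc k))))))
lemma2p16 H _ p reg T T-IFT T-narrow =
  T* , n , T*-IFT , T*-narrow , n-strictlyIncreasing , T⊆T* , λ k → T*-perm-invariant (suc k) , PermutedInto⇒G k
  where open Construction p reg T-IFT T-narrow
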